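{- For every $2$-permutation $\pi\in S_n$, $des(\pi)=(n+1)/2$.
   Context: Permutations are composed right to left; $\pi\in S_n$ is written $\langle \pi_1\ \cdots\ \pi_n\rangle$, $\pi_i=\pi(i)$, and identified with the permutation of $\{0,\ldots,n\}$ fixing $0$. $\overline{\pi}=(0,1,2,\ldots,n)\circ(0,\pi_n,\pi_{n-1},\ldots,\pi_1)$, a permutation of $\{0,\ldots,n\}$. $\pi$ is a $2$-permutation if every cycle of $\overline{\pi}$ (fixed points included) has length exactly $2$. A descent of $\pi$ is a pair $(\pi_{i-1},\pi_i)$, $2\leq i\leq n$, with $\pi_i<\pi_{i-1}$, and $des(\pi)$ is the number of descents of $\pi$. -}

module Defs where

open import Data.Nat using (ℕ; zero; suc; _+_; _<ᵇ_)
open import Data.Bool using (if_then_else_)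
open import Data.Fin using (Fin; zero; suc; toℕ; _≟_)
open import Data.Fin.Permutation using (Permutation′; _⟨$⟩ʳ_)
open import Data.List using (List; []; _∷_; map; reverse; allFin)
open import Data.Product using (_×_)
open import Function using (_∘_)
open import Relation.Nullary using (¬_; yes; no)
open import Relation.Binary.PropositionalEquality using (_≡_)

-- Conventions: π ∈ S_n is a bijection of Fin n; the value/position
-- i ∈ {1,…,n} of the paper is represented by the index i-1 ∈ Fin n.
-- The set {0,…,n} is Fin (suc n), with k ∈ {0..n} represented by k;
-- so the paper's value π_i ∈ {1..n} is 'suc (π ⟨$⟩ʳ (i-1))'.

-- The cyclic permutation (a₀, a₁, …, a_k) of Fin m written in cycle notation:
-- a_j ↦ a_{j+1}, a_k ↦ a₀, every other element is fixed.
-- cycleGo f b rest x: successor of x along b, rest…, then back to f.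
cycleGo : ∀ {m} → Fin m → Fin m → List (Fin m) → Fin m → Fin m
cycleGo f b [] x with x ≟ b
... | yes _ = f
... | no  _ = x
cycleGo f b (c ∷ cs) x with x ≟ b
... | yes _ = c
... | no  _ = cycleGo f c cs x

cycle : ∀ {m} → List (Fin m) → Fin m → Fin m
cycle [] x = x
cycle (a ∷ as) x = cycleGo a a as x

oneLine : ∀ {n} → Permutation′ n → List (Fin (suc n))
oneLine {n} π = map (suc ∘ (π ⟨$⟩ʳ_)) (allFin n)

-- π̄ = (0,1,2,…,n) ∘ (0,πₙ,πₙ₋₁,…,π₁), composed right to left.
bar : ∀ {n} → Permutation′ n → Fin (suc n) → Fin (suc n)
bar {n} π = cycle (allFin (suc n)) ∘ cycle (zero ∷ reverse (oneLine π))

-- π is a 2-permutation: every cycle of π̄ (fixed points included) has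
-- length exactly 2, i.e. each x is moved and returns after two steps.
TwoPermutation : ∀ {n} → Permutation′ n → Set
TwoPermutation {n} π =
  (x : Fin (suc n)) → (¬ (bar π x ≡ x)) × (bar π (bar π x) ≡ x)

descents : List ℕ → ℕ
descents (a ∷ b ∷ rest) = (if b <ᵇ a then 1 else 0) + descents (b ∷ rest)
descents _ = 0

des : ∀ {n} → Permutation′ n → ℕ
des {n} π = descents (map (toℕ ∘ (π ⟨$⟩ʳ_)) (allFin n))

-- π̄ is always a bijection of {0,…,n}; it sends π₁ ↦ 1 and πᵢ ↦ πᵢ₋₁ + 1 mod n+1. Reading 0
-- as n+1, πᵢ < π̄(πᵢ) thus holds exactly when πᵢ < πᵢ₋₁, and 0 < π̄(0) always, so the
-- excedances of π̄ together with the one point sent to 0 number 1 + des(π): exc(π̄) = des(π).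
-- For a 2-permutation π̄ is a fixed-point-free involution, each of its (n+1)/2 transpositions
-- {x, π̄ x} carrying exactly one excedance, whence 2·exc(π̄) = n + 1.
module Submission where

open import Defs
open import Data.Nat using (ℕ; zero; suc; _+_; _*_; _<ᵇ_)
open import Data.Nat.Properties using (+-0-commutativeMonoid; +-identityʳ; +-comm; suc-injective; <⇒<ᵇ; 1+n≢n)
open import Data.Bool using (Bool; true; false; if_then_else_; T)
open import Data.Fin using (Fin; zero; suc; toℕ; fromℕ; inject₁; _≟_)
open import Data.Fin.Properties using (toℕ-inject₁; toℕ-injective; fromℕ≢inject₁; inject₁-injective; ≤fromℕ; ≤∧≢⇒<)
import Data.Fin.Properties as Fin
open import Data.Fin.Relation.Unary.Top using (View; view; ‵fromℕ; ‵inject₁)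
open import Data.Fin.Permutation using (Permutation′; _⟨$⟩ʳ_; permutation; lift₀)
open import Data.List using ([]; _∷_; reverse; allFin; tabulate; _∷ʳ_; [_])
open import Data.List.Properties using (map-tabulate; reverse-++)
open import Data.Product using (proj₁; proj₂)
open import Function using (_∘_; id; Injective; Injection)
open import Function.Properties.Inverse using (↔⇒↣)
open import Relation.Nullary using (yes; no)
open import Relation.Nullary.Negation using (contradiction)
open import Relation.Binary.PropositionalEquality using (_≡_; _≢_; _≗_; refl; sym; trans; cong; cong₂; module ≡-Reasoning)
open import Algebra.Properties.CommutativeMonoid.Sum +-0-commutativeMonoid using (sum-syntax; ∑-distrib-+; sum-permute; sum-cong-≗; sum-replicate-zero)

private variable
  A : Set
  m n : ℕ

module _ (f b : Fin m) where

  cycleGo-head : ∀ c cs → cycleGo f b (c ∷ cs) b ≡ c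
  cycleGo-head c cs with b ≟ b
  ... | yes _ = refl
  ... | no b≢b = contradiction refl b≢b

  cycleGo-end : cycleGo f b [] b ≡ f
  cycleGo-end with b ≟ b
  ... | yes _ = refl
  ... | no b≢b = contradiction refl b≢b

  cycleGo-skip : ∀ {x c cs} → x ≢ b → cycleGo f b (c ∷ cs) x ≡ cycleGo f c cs x
  cycleGo-skip {x} x≢b with x ≟ b
  ... | yes x≡b = contradiction x≡b x≢b
  ... | no _ = refl

successorOr : A → (Fin (suc n) → A) → Fin (suc n) → A
successorOr {n = zero} f h zero = f
successorOr {n = suc n} f h zero = h (suc zero)
successorOr {n = suc n} f h (suc j) = successorOr f (h ∘ suc) j

successorOr-fromℕ : ∀ n (f : A) h → successorOr f h (fromℕ n) ≡ f
successorOr-fromℕ zero f h = refl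
successorOr-fromℕ (suc n) f h = successorOr-fromℕ n f (h ∘ suc)

successorOr-inject₁ : ∀ (f : A) h (i : Fin n) → successorOr f h (inject₁ i) ≡ h (suc i)
successorOr-inject₁ f h zero = refl
successorOr-inject₁ f h (suc i) = successorOr-inject₁ f (h ∘ suc) i

predecessorOr : A → (Fin n → A) → Fin n → A
predecessorOr f g zero = f
predecessorOr f g (suc k) = g (inject₁ k)

predecessorOr-inject₁ : ∀ (f : A) (g : Fin (suc n) → A) i →
                        predecessorOr f (g ∘ inject₁) i ≡ predecessorOr f g (inject₁ i)
predecessorOr-inject₁ f g zero = refl
predecessorOr-inject₁ f g (suc i) = refl

cycleGo-tabulate : ∀ n (f : Fin m) (h : Fin (suc n) → Fin m) → Injective _≡_ _≡_ h →
                   ∀ j → cycleGo f (h zero) (tabulate (h ∘ suc)) (h j) ≡ successorOr f h j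
cycleGo-tabulate zero f h h-inj zero = cycleGo-end f (h zero)
cycleGo-tabulate (suc n) f h h-inj zero = cycleGo-head f (h zero) _ _
cycleGo-tabulate (suc n) f h h-inj (suc j) =
  trans (cycleGo-skip f (h zero) (λ e → Fin.0≢1+n (sym (h-inj e))))
        (cycleGo-tabulate n f (h ∘ suc) (Fin.suc-injective ∘ h-inj) j)

cycle-tabulate : ∀ (h : Fin (suc n) → Fin m) → Injective _≡_ _≡_ h →
                 ∀ j → cycle (tabulate h) (h j) ≡ successorOr (h zero) h j
cycle-tabulate h h-inj = cycleGo-tabulate _ (h zero) h h-inj

tabulate-∷ʳ : ∀ n (h : Fin (suc n) → A) → tabulate h ≡ tabulate (h ∘ inject₁) ∷ʳ h (fromℕ n)
tabulate-∷ʳ zero h = refl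
tabulate-∷ʳ (suc n) h = cong (h zero ∷_) (tabulate-∷ʳ n (h ∘ suc))

reverse-tabulate : ∀ n (h : Fin (suc n) → A) →
                   reverse (tabulate h) ≡ h (fromℕ n) ∷ reverse (tabulate (h ∘ inject₁))
reverse-tabulate n h =
  trans (cong reverse (tabulate-∷ʳ n h)) (reverse-++ (tabulate (h ∘ inject₁)) [ h (fromℕ n) ])

cycleGo-reverse-tabulate : ∀ n (f b : Fin m) (g : Fin (suc n) → Fin m) → Injective _≡_ _≡_ g →
                           (∀ j → g j ≢ b) →
                           ∀ j → cycleGo f b (reverse (tabulate g)) (g j) ≡ predecessorOr f g j
cycleGo-reverse-tabulate zero f b g g-inj g≢b zero =
  trans (cycleGo-skip f b (g≢b zero)) (cycleGo-end f (g zero))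
cycleGo-reverse-tabulate {m} (suc n) f b g g-inj g≢b j
  rewrite reverse-tabulate (suc n) g = trans (cycleGo-skip f b (g≢b j)) (rest j (view j))
  where
  c : Fin m
  c = g (fromℕ (suc n))
  rest : ∀ j → View j →
              cycleGo f c (reverse (tabulate (g ∘ inject₁))) (g j) ≡ predecessorOr f g j
  rest _ ‵fromℕ rewrite reverse-tabulate n (g ∘ inject₁) = cycleGo-head f c _ _
  rest _ (‵inject₁ i) =
    trans (cycleGo-reverse-tabulate n f c (g ∘ inject₁) (inject₁-injective ∘ g-inj)
                                    (λ j e → fromℕ≢inject₁ (sym (g-inj e))) i)
          (predecessorOr-inject₁ f g i)

⟨$⟩ʳ-injective : ∀ (π : Permutation′ n) → Injective _≡_ _≡_ (π ⟨$⟩ʳ_)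
⟨$⟩ʳ-injective π = Injection.injective (↔⇒↣ π)

rotate : Fin (suc n) → Fin (suc n)
rotate = successorOr zero id

cycle-allFin : ∀ n → cycle (allFin (suc n)) ≗ rotate
cycle-allFin n = cycle-tabulate id id

bar-suc : ∀ (π : Permutation′ (suc n)) j →
          bar π (suc (π ⟨$⟩ʳ j)) ≡ rotate (predecessorOr zero (suc ∘ (π ⟨$⟩ʳ_)) j)
bar-suc {n} π j = begin
  cycle (allFin (suc (suc n))) (cycleGo zero zero (reverse (oneLine π)) (g j))
    ≡⟨ cong (λ l → cycle (allFin (suc (suc n))) (cycleGo zero zero (reverse l) (g j))) (map-tabulate id g) ⟩
  cycle (allFin (suc (suc n))) (cycleGo zero zero (reverse (tabulate g)) (g j))
    ≡⟨ cong (cycle (allFin (suc (suc n))))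
            (cycleGo-reverse-tabulate n zero zero g (⟨$⟩ʳ-injective π ∘ Fin.suc-injective) (λ _ ()) j) ⟩
  cycle (allFin (suc (suc n))) (predecessorOr zero g j)
    ≡⟨ cycle-allFin (suc n) (predecessorOr zero g j) ⟩
  rotate (predecessorOr zero g j) ∎
  where
  open ≡-Reasoning
  g : Fin (suc n) → Fin (suc (suc n))
  g = suc ∘ (π ⟨$⟩ʳ_)

𝟙 : Bool → ℕ
𝟙 b = if b then 1 else 0

infix 4 _<ᶠ_
_<ᶠ_ : Fin n → Fin n → Bool
x <ᶠ y = toℕ x <ᵇ toℕ y

isZero : Fin n → Bool
isZero zero = true
isZero (suc _) = false

T⇒𝟙≡1 : ∀ {b} → T b → 𝟙 b ≡ 1
T⇒𝟙≡1 {true} _ = refl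

m≢n⇒𝟙[m<ᵇn]+𝟙[n<ᵇm]≡1 : ∀ a b → a ≢ b → 𝟙 (a <ᵇ b) + 𝟙 (b <ᵇ a) ≡ 1
m≢n⇒𝟙[m<ᵇn]+𝟙[n<ᵇm]≡1 zero zero a≢b = contradiction refl a≢b
m≢n⇒𝟙[m<ᵇn]+𝟙[n<ᵇm]≡1 zero (suc b) _ = refl
m≢n⇒𝟙[m<ᵇn]+𝟙[n<ᵇm]≡1 (suc a) zero _ = refl
m≢n⇒𝟙[m<ᵇn]+𝟙[n<ᵇm]≡1 (suc a) (suc b) a≢b = m≢n⇒𝟙[m<ᵇn]+𝟙[n<ᵇm]≡1 a b (a≢b ∘ cong suc)

m≢n⇒m<ᵇ1+n≡m<ᵇn : ∀ a b → a ≢ b → (a <ᵇ suc b) ≡ (a <ᵇ b)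
m≢n⇒m<ᵇ1+n≡m<ᵇn zero zero a≢b = contradiction refl a≢b
m≢n⇒m<ᵇ1+n≡m<ᵇn zero (suc b) _ = refl
m≢n⇒m<ᵇ1+n≡m<ᵇn (suc a) zero _ = refl
m≢n⇒m<ᵇ1+n≡m<ᵇn (suc a) (suc b) a≢b = m≢n⇒m<ᵇ1+n≡m<ᵇn a b (a≢b ∘ cong suc)

-- For x ≢ 0, lt⁰ x y indicates x < y in the order of Fin (suc n) that puts 0 on top.
lt⁰ : Fin (suc n) → Fin (suc n) → ℕ
lt⁰ x y = 𝟙 (x <ᶠ y) + 𝟙 (isZero y)

lt⁰-zero : ∀ (y : Fin (suc n)) → lt⁰ zero y ≡ 1
lt⁰-zero zero = refl
lt⁰-zero (suc y) = refl

lt⁰-rotate : ∀ (x y : Fin (suc n)) → x ≢ y → lt⁰ x (rotate y) ≡ 𝟙 (x <ᶠ y)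
lt⁰-rotate {n} x y x≢y with view y
... | ‵fromℕ rewrite successorOr-fromℕ n zero id = sym (T⇒𝟙≡1 (<⇒<ᵇ (≤∧≢⇒< (≤fromℕ x) x≢y)))
... | ‵inject₁ i rewrite successorOr-inject₁ zero id i | toℕ-inject₁ i =
  trans (+-identityʳ _) (cong 𝟙 (m≢n⇒m<ᵇ1+n≡m<ᵇn (toℕ x) (toℕ i) toℕx≢toℕi))
  where
  toℕx≢toℕi : toℕ x ≢ toℕ i
  toℕx≢toℕi e = x≢y (toℕ-injective (trans e (sym (toℕ-inject₁ i))))

excedances : (Fin n → Fin n) → ℕ
excedances {n} σ = ∑[ x < n ] 𝟙 (x <ᶠ σ x)

∑-one : ∀ n → ∑[ x < n ] 1 ≡ n
∑-one zero = refl
∑-one (suc n) = cong suc (∑-one n)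

∑-isZero-permute : ∀ (σ : Permutation′ (suc n)) → ∑[ x < suc n ] 𝟙 (isZero (σ ⟨$⟩ʳ x)) ≡ 1
∑-isZero-permute {n} σ = trans (sym (sum-permute (𝟙 ∘ isZero) σ)) (cong suc (sum-replicate-zero n))

involution⇒2*excedances≡n : ∀ (σ : Fin n → Fin n) → (∀ x → σ (σ x) ≡ x) → (∀ x → σ x ≢ x) →
                           2 * excedances σ ≡ n
involution⇒2*excedances≡n {n} σ σ²≡id σx≢x = begin
  2 * excedances σ                                ≡⟨ cong (excedances σ +_) (+-identityʳ _) ⟩
  excedances σ + excedances σ                     ≡⟨ cong (excedances σ +_) reversed ⟩
  excedances σ + ∑[ x < n ] 𝟙 (σ x <ᶠ x)          ≡⟨ sym (∑-distrib-+ (λ x → 𝟙 (x <ᶠ σ x)) (λ x → 𝟙 (σ x <ᶠ x))) ⟩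
  ∑[ x < n ] (𝟙 (x <ᶠ σ x) + 𝟙 (σ x <ᶠ x))        ≡⟨ sum-cong-≗ (λ x → m≢n⇒𝟙[m<ᵇn]+𝟙[n<ᵇm]≡1 _ _ (σx≢x x ∘ toℕ-injective ∘ sym)) ⟩
  ∑[ x < n ] 1                                    ≡⟨ ∑-one n ⟩
  n                                               ∎
  where
  open ≡-Reasoning
  reversed : excedances σ ≡ ∑[ x < n ] 𝟙 (σ x <ᶠ x)
  reversed = trans (sum-permute _ (permutation σ σ σ²≡id σ²≡id))
                   (sum-cong-≗ (λ x → cong (λ y → 𝟙 (σ x <ᶠ y)) (σ²≡id x)))

descents-tabulate : ∀ n (a : Fin (suc n) → ℕ) →
                    descents (tabulate a) ≡ ∑[ k < n ] 𝟙 (a (suc k) <ᵇ a (inject₁ k))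
descents-tabulate zero a = refl
descents-tabulate (suc n) a = cong (𝟙 (a (suc zero) <ᵇ a zero) +_) (descents-tabulate n (a ∘ suc))

des≡∑ : ∀ (π : Permutation′ (suc n)) → des π ≡ ∑[ k < n ] 𝟙 (π ⟨$⟩ʳ suc k <ᶠ π ⟨$⟩ʳ inject₁ k)
des≡∑ {n} π = trans (cong descents (map-tabulate id a)) (descents-tabulate n a)
  where
  a : Fin (suc n) → ℕ
  a = toℕ ∘ (π ⟨$⟩ʳ_)

∑-lt⁰-bar-oneLine : ∀ (π : Permutation′ n) →
                    ∑[ j < n ] lt⁰ (suc (π ⟨$⟩ʳ j)) (bar π (suc (π ⟨$⟩ʳ j))) ≡ des π
∑-lt⁰-bar-oneLine {zero} π = refl
∑-lt⁰-bar-oneLine {suc n} π = begin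
  ∑[ j < suc n ] lt⁰ (g j) (bar π (g j))
    ≡⟨ sum-cong-≗ (λ j → cong (lt⁰ (g j)) (bar-suc π j)) ⟩
  ∑[ j < suc n ] lt⁰ (g j) (rotate (predecessorOr zero g j))
    ≡⟨ sum-cong-≗ (λ j → lt⁰-rotate (g j) (predecessorOr zero g j) (g≢predecessor j)) ⟩
  ∑[ j < suc n ] 𝟙 (g j <ᶠ predecessorOr zero g j)
    ≡⟨ des≡∑ π ⟨
  des π ∎
  where
  open ≡-Reasoning
  g : Fin (suc n) → Fin (suc (suc n))
  g = suc ∘ (π ⟨$⟩ʳ_)
  g≢predecessor : ∀ j → g j ≢ predecessorOr zero g j
  g≢predecessor zero ()
  g≢predecessor (suc k) e =
    1+n≢n (trans (cong toℕ (⟨$⟩ʳ-injective π (Fin.suc-injective e))) (toℕ-inject₁ k))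

∑-lt⁰-bar : ∀ (π : Permutation′ n) → ∑[ x < suc n ] lt⁰ x (bar π x) ≡ suc (des π)
∑-lt⁰-bar π = begin
  ∑[ x < _ ] lt⁰ x (bar π x)
    ≡⟨ sum-permute (λ x → lt⁰ x (bar π x)) (lift₀ π) ⟩
  lt⁰ zero (bar π zero) + ∑[ j < _ ] lt⁰ (suc (π ⟨$⟩ʳ j)) (bar π (suc (π ⟨$⟩ʳ j)))
    ≡⟨ cong₂ _+_ (lt⁰-zero (bar π zero)) (∑-lt⁰-bar-oneLine π) ⟩
  suc (des π) ∎
  where open ≡-Reasoning

involution-bar⇒des≡excedances : ∀ (π : Permutation′ n) → (∀ x → bar π (bar π x) ≡ x) →
                                des π ≡ excedances (bar π)
involution-bar⇒des≡excedances {n} π bar²≡id = suc-injective (begin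
  suc (des π)                                                ≡⟨ ∑-lt⁰-bar π ⟨
  ∑[ x < suc n ] lt⁰ x (bar π x)                             ≡⟨ ∑-distrib-+ (λ x → 𝟙 (x <ᶠ bar π x)) (𝟙 ∘ isZero ∘ bar π) ⟩
  excedances (bar π) + ∑[ x < suc n ] 𝟙 (isZero (bar π x))   ≡⟨ cong (excedances (bar π) +_) (∑-isZero-permute π̄) ⟩
  excedances (bar π) + 1                                     ≡⟨ +-comm (excedances (bar π)) 1 ⟩
  suc (excedances (bar π))                                   ∎)
  where
  open ≡-Reasoning
  π̄ : Permutation′ (suc n)
  π̄ = permutation (bar π) (bar π) bar²≡id bar²≡id

proposition2 : (n : ℕ) (π : Permutation′ n) → TwoPermutation π → 2 * des π ≡ suc n
proposition2 n π two = begin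
  2 * des π               ≡⟨ cong (2 *_) (involution-bar⇒des≡excedances π bar²≡id) ⟩
  2 * excedances (bar π)  ≡⟨ involution⇒2*excedances≡n (bar π) bar²≡id (proj₁ ∘ two) ⟩
  suc n                   ∎
  where
  open ≡-Reasoning
  bar²≡id : ∀ x → bar π (bar π x) ≡ x
  bar²≡id = proj₂ ∘ two
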